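{- For every integer $k\ge5$, the digits $0$ and $1$ are uniformly distributed in the sequence $(\Phi_{2^k}(n))_{n\in\mathbb{N}}$, i.e. each occurs with frequency exactly $1/2$ in one shortest period of this sequence.
   Context: The Fibonacci numbers are $F_0=0$, $F_1=1$, $F_n=F_{n-1}+F_{n-2}$. $\Phi_{2^k}(n)=\lfloor F_n/2^k\rfloor \bmod 2$ is the $2^k$'s place binary digit of $F_n$; this sequence is periodic in $n$. -}

module Defs where

open import Data.Nat using (ℕ; zero; suc; _+_; _*_; _^_; _≤_; _<_; NonZero)
open import Data.Nat.DivMod using (_/_; _%_)
open import Data.Nat.Properties using (m^n≢0)
open import Data.List using (List; length; filter; upTo)
open import Data.Product using (_×_)
open import Relation.Binary.PropositionalEquality using (_≡_)
import Data.Nat as ℕ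

fib : ℕ → ℕ
fib zero = 0
fib (suc zero) = 1
fib (suc (suc n)) = fib (suc n) + fib n

Φ : ℕ → ℕ → ℕ
Φ k n = (_/_ (fib n) (2 ^ k) {{m^n≢0 2 k}}) % 2

IsPeriod : (ℕ → ℕ) → ℕ → Set
IsPeriod s p = (0 < p) × (∀ n → s (n + p) ≡ s n)

IsShortestPeriod : (ℕ → ℕ) → ℕ → Set
IsShortestPeriod s p = IsPeriod s p × (∀ q → IsPeriod s q → p ≤ q)

countDigit : (ℕ → ℕ) → ℕ → ℕ → ℕ
countDigit s d p = length (filter (λ n → s n ℕ.≟ d) (upTo p))

module Submission where

-- Let L i = 3·2^(i+2). Doubling with the addition formula shows F (n + L i) = F n + 2^(i+3) (C F n + 2 A F (n+1))
-- with A ≡ 1, C ≡ 3 (mod 4). Reading off the 2^k digit for k ≥ 5: it has period 3·2^k; a shift by half of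
-- that flips the digit where F n is odd, i.e. for n ≢ 0 (mod 3); a quarter shift flips it for n ≡ 0 (mod 6)
-- and an eighth for n ≡ 3 (mod 6), by the residues of F mod 8. So the digit is antiperiodic on each residue
-- class mod 6, and each class contributes equally many 0s and 1s to a period. A shorter period would make
-- its gcd with 3·2^k a proper divisor, hence make 3·2^(k-1) or 2^k a period, and the flips exclude both.

open import Defs
open import Data.Nat
open import Data.Nat.Properties
open import Data.Nat.DivMod
open import Data.Nat.Divisibility
open import Data.Nat.GCD using (gcd; gcd-GCD; gcd[m,n]∣m; gcd[m,n]∣n; module Bézout)
open import Data.Nat.Coprimality using (Coprime; coprime-divisor)
open import Data.Nat.Primality using (Prime; prime[2]; prime?; prime⇒irreducible)
open import Data.Nat.Tactic.RingSolver using (solve-∀)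
open import Data.List using ([_]; _++_; length; filter; upTo)
open import Data.List.Properties using (applyUpTo-∷ʳ; filter-++; length-++; filter-accept; filter-reject)
open import Data.Product using (Σ; ∃; ∃₂; _×_; _,_)
open import Data.Sum using (_⊎_; inj₁; inj₂)
open import Data.Empty using (⊥; ⊥-elim)
open import Function using (_∘_)
open import Relation.Nullary using (¬_; yes; no)
open import Relation.Nullary.Decidable using (toWitness)
open import Relation.Binary.PropositionalEquality hiding ([_])

fib-+ : ∀ m n → fib (suc m + n) ≡ fib m * fib n + fib (suc m) * fib (suc n)
fib-+ zero n = sym (+-identityʳ (fib (suc n)))
fib-+ (suc m) n = begin
    fib (suc (suc m) + n)
  ≡⟨ cong fib (sym (+-suc (suc m) n)) ⟩
    fib (suc m + suc n)
  ≡⟨ fib-+ m (suc n) ⟩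
    fib m * fib (suc n) + fib (suc m) * (fib (suc n) + fib n)
  ≡⟨ lemma (fib m) (fib (suc m)) (fib n) (fib (suc n)) ⟩
    fib (suc m) * fib n + (fib (suc m) + fib m) * fib (suc n)
  ∎
  where
    open ≡-Reasoning
    lemma : ∀ a b x y → a * y + b * (y + x) ≡ b * x + (b + a) * y
    lemma = solve-∀

-- By fib-+, F (n + L) = F (L ∸ 1) F n + F L F (n + 1); the law records
-- F (L ∸ 1) = 1 + 2^(3+i) (4c+3) and F L = 2^(4+i) (4a+1).
ShiftLaw : ℕ → ℕ → Set
ShiftLaw i L = ∃₂ λ a c → ∀ n →
  fib (n + L) ≡ fib n + 2 ^ (3 + i) * ((4 * c + 3) * fib n + 2 * (4 * a + 1) * fib (suc n))

shiftLaw-12 : ShiftLaw 0 12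
shiftLaw-12 = 2 , 2 , λ n → begin
    fib (n + 12)     ≡⟨ cong fib (+-comm n 12) ⟩
    fib (12 + n)     ≡⟨ fib-+ 11 n ⟩
    89 * fib n + 144 * fib (suc n)
                     ≡⟨ lemma (fib n) (fib (suc n)) ⟩
    fib n + 8 * (11 * fib n + 18 * fib (suc n)) ∎
  where
    open ≡-Reasoning
    lemma : ∀ x y → 89 * x + 144 * y ≡ x + 8 * (11 * x + 18 * y)
    lemma = solve-∀

shiftLaw-double : ∀ {i L} → ShiftLaw i L → ShiftLaw (suc i) (L + L)
shiftLaw-double {i} {L} (a , c , law) = a′ , c′ , λ n → begin
    fib (n + (L + L))
  ≡⟨ cong fib (sym (+-assoc n L L)) ⟩
    fib (n + L + L)
  ≡⟨ law (n + L) ⟩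
    fib (n + L) + 2 ^ (3 + i) * (C * fib (n + L) + 2 * A * fib (suc n + L))
  ≡⟨ cong₂ (λ x y → x + 2 ^ (3 + i) * (C * x + 2 * A * y)) (law n) (law (suc n)) ⟩
    _
  ≡⟨ lemma (2 ^ i) a c (fib n) (fib (suc n)) ⟩
    fib n + 2 ^ (4 + i) * ((4 * c′ + 3) * fib n + 2 * (4 * a′ + 1) * fib (suc n)) ∎
  where
    open ≡-Reasoning
    A = 4 * a + 1
    C = 4 * c + 3
    a′ = a + 2 * 2 ^ i * A * (C + A)
    c′ = c + 2 ^ i * (C * C + 4 * A * A)
    lemma : ∀ E a c x y → let A = 4 * a + 1; C = 4 * c + 3; D = λ x y → C * x + 2 * A * y in
      let E₃ = 2 * (2 * (2 * E)) in
      x + E₃ * D x y + E₃ * (C * (x + E₃ * D x y) + 2 * A * (y + E₃ * D y (y + x)))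
        ≡ x + 2 * E₃ * ((4 * (c + E * (C * C + 4 * A * A)) + 3) * x + 2 * (4 * (a + 2 * E * A * (C + A)) + 1) * y)
    lemma = solve-∀

-- Opaque so that the conversion checker never unfolds the ring-solver proofs inside.
opaque
  shiftLaw : ∀ i → ShiftLaw i (3 * 2 ^ (2 + i))
  shiftLaw zero = shiftLaw-12
  shiftLaw (suc i) = subst (ShiftLaw (suc i)) (double (2 ^ (2 + i))) (shiftLaw-double {i} (shiftLaw i))
    where
      double : ∀ E → 3 * E + 3 * E ≡ 3 * (2 * E)
      double = solve-∀

fib-mod8 : ∀ u → ∃₂ λ p q → fib (u * 6) ≡ 8 * p × fib (1 + u * 6) ≡ 4 * q + 1
fib-mod8 zero = 0 , 0 , refl , refl
fib-mod8 (suc u) with fib-mod8 u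
... | p , q , F≡ , F′≡ =
  5 * p + 4 * q + 1 , 16 * p + 13 * q + 3 ,
  trans (fib-+ 5 (u * 6)) (trans (cong₂ (λ F F′ → 5 * F + 8 * F′) F≡ F′≡) (lemma₁ p q)) ,
  trans (fib-+ 6 (u * 6)) (trans (cong₂ (λ F F′ → 8 * F + 13 * F′) F≡ F′≡) (lemma₂ p q))
  where
    lemma₁ : ∀ p q → 5 * (8 * p) + 8 * (4 * q + 1) ≡ 8 * (5 * p + 4 * q + 1)
    lemma₁ = solve-∀
    lemma₂ : ∀ p q → 8 * (8 * p) + 13 * (4 * q + 1) ≡ 4 * (16 * p + 13 * q + 3) + 1
    lemma₂ = solve-∀

Odd : ℕ → Set
Odd x = ∃ λ v → x ≡ 2 * v + 1

fib-odd-1+6u : ∀ u → Odd (fib (1 + u * 6))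
fib-odd-1+6u u with fib-mod8 u
... | p , q , F≡ , F′≡ = 2 * q , trans F′≡ (lemma q)
  where
    lemma : ∀ q → 4 * q + 1 ≡ 2 * (2 * q) + 1
    lemma = solve-∀

fib-odd-2+6u : ∀ u → Odd (fib (2 + u * 6))
fib-odd-2+6u u with fib-mod8 u
... | p , q , F≡ , F′≡ = 4 * p + 2 * q , trans (cong₂ (λ F F′ → F′ + F) F≡ F′≡) (lemma p q)
  where
    lemma : ∀ p q → 4 * q + 1 + 8 * p ≡ 2 * (4 * p + 2 * q) + 1
    lemma = solve-∀

fib-odd-4+6u : ∀ u → Odd (fib (4 + u * 6))
fib-odd-4+6u u with fib-mod8 u
... | p , q , F≡ , F′≡ = 8 * p + 6 * q + 1 ,
  trans (cong₂ (λ F F′ → F′ + F + F′ + (F′ + F)) F≡ F′≡) (lemma p q)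
  where
    lemma : ∀ p q → 4 * q + 1 + 8 * p + (4 * q + 1) + (4 * q + 1 + 8 * p) ≡ 2 * (8 * p + 6 * q + 1) + 1
    lemma = solve-∀

fib-3+6u : ∀ u → ∃₂ λ r s → fib (3 + u * 6) ≡ 8 * r + 2 × fib (4 + u * 6) ≡ 4 * s + 3
fib-3+6u u with fib-mod8 u
... | p , q , F≡ , F′≡ = p + q , 4 * p + 3 * q ,
  trans (cong₂ (λ F F′ → F′ + F + F′) F≡ F′≡) (lemma₃ p q) ,
  trans (cong₂ (λ F F′ → F′ + F + F′ + (F′ + F)) F≡ F′≡) (lemma₄ p q)
  where
    lemma₃ : ∀ p q → 4 * q + 1 + 8 * p + (4 * q + 1) ≡ 8 * (p + q) + 2
    lemma₃ = solve-∀
    lemma₄ : ∀ p q → 4 * q + 1 + 8 * p + (4 * q + 1) + (4 * q + 1 + 8 * p) ≡ 4 * (4 * p + 3 * q) + 3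
    lemma₄ = solve-∀

fib-odd-5+6u : ∀ u → Odd (fib (5 + u * 6))
fib-odd-5+6u u with fib-mod8 u
... | p , q , F≡ , F′≡ = 12 * p + 10 * q + 2 ,
  trans (cong₂ (λ F F′ → F′ + F + F′ + (F′ + F) + (F′ + F + F′)) F≡ F′≡) (lemma p q)
  where
    lemma : ∀ p q → 4 * q + 1 + 8 * p + (4 * q + 1) + (4 * q + 1 + 8 * p) + (4 * q + 1 + 8 * p + (4 * q + 1))
                  ≡ 2 * (12 * p + 10 * q + 2) + 1
    lemma = solve-∀

2^suc-mod6 : ∀ j → ∃ λ u → 2 ^ suc j ≡ 2 + u * 6 ⊎ 2 ^ suc j ≡ 4 + u * 6
2^suc-mod6 zero = 0 , inj₁ refl
2^suc-mod6 (suc j) with 2^suc-mod6 j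
... | u , inj₁ eq = 2 * u , inj₂ (trans (cong (2 *_) eq) (lemma₂ u))
  where
    lemma₂ : ∀ u → 2 * (2 + u * 6) ≡ 4 + 2 * u * 6
    lemma₂ = solve-∀
... | u , inj₂ eq = 1 + 2 * u , inj₁ (trans (cong (2 *_) eq) (lemma₄ u))
  where
    lemma₄ : ∀ u → 2 * (4 + u * 6) ≡ 2 + (1 + 2 * u) * 6
    lemma₄ = solve-∀

fib-odd-2^suc : ∀ j → Odd (fib (2 ^ suc j))
fib-odd-2^suc j with 2^suc-mod6 j
... | u , inj₁ eq = subst (Odd ∘ fib) (sym eq) (fib-odd-2+6u u)
... | u , inj₂ eq = subst (Odd ∘ fib) (sym eq) (fib-odd-4+6u u)

[1+q]%2+q%2≡1 : ∀ q → suc q % 2 + q % 2 ≡ 1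
[1+q]%2+q%2≡1 zero = refl
[1+q]%2+q%2≡1 (suc zero) = refl
[1+q]%2+q%2≡1 (suc (suc q)) =
  trans (cong₂ _+_ ([2+y]%2≡y%2 (suc q)) ([2+y]%2≡y%2 q)) ([1+q]%2+q%2≡1 q)
  where
    [2+y]%2≡y%2 : ∀ y → (2 + y) % 2 ≡ y % 2
    [2+y]%2≡y%2 y = trans (cong (_% 2) (+-comm 2 y)) ([m+n]%n≡m%n y 2)

module _ (k : ℕ) where
  private
    instance
      2^k≢0 : NonZero (2 ^ k)
      2^k≢0 = m^n≢0 2 k

  digit : ℕ → ℕ
  digit x = x / 2 ^ k % 2

  digit≤1 : ∀ x → digit x ≤ 1
  digit≤1 x = ≤-pred (m%n<n (x / 2 ^ k) 2)

  [x+2^k*t]/2^k≡x/2^k+t : ∀ x t → (x + 2 ^ k * t) / 2 ^ k ≡ x / 2 ^ k + t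
  [x+2^k*t]/2^k≡x/2^k+t x t = begin
      (x + 2 ^ k * t) / 2 ^ k       ≡⟨ cong (λ y → (x + y) / 2 ^ k) (*-comm (2 ^ k) t) ⟩
      (x + t * 2 ^ k) / 2 ^ k       ≡⟨ +-distrib-/-∣ʳ x (n∣m*n t) ⟩
      x / 2 ^ k + t * 2 ^ k / 2 ^ k ≡⟨ cong (x / 2 ^ k +_) (m*n/n≡m t (2 ^ k)) ⟩
      x / 2 ^ k + t                 ∎
    where open ≡-Reasoning

  digit-keep : ∀ {x y} t → y ≡ x + 2 ^ k * (2 * t) → digit y ≡ digit x
  digit-keep {x} t refl = begin
      (x + 2 ^ k * (2 * t)) / 2 ^ k % 2 ≡⟨ cong (_% 2) ([x+2^k*t]/2^k≡x/2^k+t x (2 * t)) ⟩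
      (x / 2 ^ k + 2 * t) % 2           ≡⟨ cong (λ z → (x / 2 ^ k + z) % 2) (*-comm 2 t) ⟩
      (x / 2 ^ k + t * 2) % 2           ≡⟨ [m+kn]%n≡m%n (x / 2 ^ k) t 2 ⟩
      x / 2 ^ k % 2                     ∎
    where open ≡-Reasoning

  digit-flip : ∀ {x y} w → y ≡ x + 2 ^ k * (2 * w + 1) → digit y + digit x ≡ 1
  digit-flip {x} w refl = begin
      (x + 2 ^ k * (2 * w + 1)) / 2 ^ k % 2 + q % 2
        ≡⟨ cong (λ z → z % 2 + q % 2) ([x+2^k*t]/2^k≡x/2^k+t x (2 * w + 1)) ⟩
      (q + (2 * w + 1)) % 2 + q % 2 ≡⟨ cong (λ z → z % 2 + q % 2) (rearrange q w) ⟩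
      (suc q + w * 2) % 2 + q % 2   ≡⟨ cong (_+ q % 2) ([m+kn]%n≡m%n (suc q) w 2) ⟩
      suc q % 2 + q % 2             ≡⟨ [1+q]%2+q%2≡1 q ⟩
      1                             ∎
    where
      open ≡-Reasoning
      q = x / 2 ^ k
      rearrange : ∀ q w → q + (2 * w + 1) ≡ suc q + w * 2
      rearrange = solve-∀

2^suc*x≡2^j*2x : ∀ j x → 2 ^ suc j * x ≡ 2 ^ j * (2 * x)
2^suc*x≡2^j*2x j x = lemma (2 ^ j) x
  where
    lemma : ∀ E x → 2 * E * x ≡ E * (2 * x)
    lemma = solve-∀

class-index : ∀ r v j → r + (v + 2 ^ j) * 6 ≡ r + v * 6 + 3 * 2 ^ suc j
class-index r v j = lemma r v (2 ^ j)
  where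
    lemma : ∀ r v E → r + (v + E) * 6 ≡ r + v * 6 + 3 * (2 * E)
    lemma = solve-∀

Periodic : (ℕ → ℕ) → ℕ → Set
Periodic s p = ∀ n → s (n + p) ≡ s n

sumBelow : (ℕ → ℕ) → ℕ → ℕ
sumBelow f zero = 0
sumBelow f (suc n) = sumBelow f n + f n

sumBelow-cong : ∀ {f g} n → (∀ i → i < n → f i ≡ g i) → sumBelow f n ≡ sumBelow g n
sumBelow-cong zero eq = refl
sumBelow-cong (suc n) eq = cong₂ _+_ (sumBelow-cong n (λ i i<n → eq i (m<n⇒m<1+n i<n))) (eq n ≤-refl)

sumBelow-const : ∀ c n → sumBelow (λ _ → c) n ≡ n * c
sumBelow-const c zero = refl
sumBelow-const c (suc n) = trans (cong (_+ c) (sumBelow-const c n)) (+-comm (n * c) c)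

sumBelow-+ : ∀ f g n → sumBelow (λ i → f i + g i) n ≡ sumBelow f n + sumBelow g n
sumBelow-+ f g zero = refl
sumBelow-+ f g (suc n) =
  trans (cong (_+ (f n + g n)) (sumBelow-+ f g n)) (lemma (sumBelow f n) (sumBelow g n) (f n) (g n))
  where
    lemma : ∀ a b c d → a + b + (c + d) ≡ a + c + (b + d)
    lemma = solve-∀

*-distribˡ-sumBelow : ∀ c f n → c * sumBelow f n ≡ sumBelow (λ i → c * f i) n
*-distribˡ-sumBelow c f zero = *-zeroʳ c
*-distribˡ-sumBelow c f (suc n) =
  trans (*-distribˡ-+ c (sumBelow f n) (f n)) (cong (_+ c * f n) (*-distribˡ-sumBelow c f n))

sumBelow-split : ∀ f m n → sumBelow f (m + n) ≡ sumBelow f m + sumBelow (λ i → f (m + i)) n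
sumBelow-split f m zero = trans (cong (sumBelow f) (+-identityʳ m)) (sym (+-identityʳ _))
sumBelow-split f m (suc n) = begin
    sumBelow f (m + suc n)                                    ≡⟨ cong (sumBelow f) (+-suc m n) ⟩
    sumBelow f (m + n) + f (m + n)                            ≡⟨ cong (_+ f (m + n)) (sumBelow-split f m n) ⟩
    sumBelow f m + sumBelow (λ i → f (m + i)) n + f (m + n)   ≡⟨ +-assoc (sumBelow f m) _ _ ⟩
    sumBelow f m + sumBelow (λ i → f (m + i)) (suc n)         ∎
  where open ≡-Reasoning

sumBelow-residues : ∀ f d u → sumBelow f (u * d) ≡ sumBelow (λ r → sumBelow (λ v → f (r + v * d)) u) d
sumBelow-residues f d zero = sym (trans (sumBelow-const 0 d) (*-zeroʳ d))
sumBelow-residues f d (suc u) = begin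
    sumBelow f (d + u * d)
  ≡⟨ cong (sumBelow f) (+-comm d (u * d)) ⟩
    sumBelow f (u * d + d)
  ≡⟨ sumBelow-split f (u * d) d ⟩
    sumBelow f (u * d) + sumBelow (λ r → f (u * d + r)) d
  ≡⟨ cong₂ _+_ (sumBelow-residues f d u) (sumBelow-cong d (λ r _ → cong f (+-comm (u * d) r))) ⟩
    sumBelow (λ r → sumBelow (λ v → f (r + v * d)) u) d + sumBelow (λ r → f (r + u * d)) d
  ≡⟨ sumBelow-+ (λ r → sumBelow (λ v → f (r + v * d)) u) (λ r → f (r + u * d)) d ⟨
    sumBelow (λ r → sumBelow (λ v → f (r + v * d)) (suc u)) d
  ∎
  where open ≡-Reasoning

sumBelow-unshift : ∀ f n → sumBelow f (suc n) ≡ f 0 + sumBelow (λ i → f (suc i)) n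
sumBelow-unshift f zero = +-comm 0 (f 0)
sumBelow-unshift f (suc n) = trans (cong (_+ f (suc n)) (sumBelow-unshift f n)) (+-assoc (f 0) _ _)

sumBelow-rotate : ∀ {f p} → Periodic f p → ∀ e → sumBelow (λ i → f (i + e)) p ≡ sumBelow f p
sumBelow-rotate {f} {p} per zero = sumBelow-cong p (λ i _ → cong f (+-identityʳ i))
sumBelow-rotate {f} {p} per (suc e) = begin
    sumBelow (λ i → f (i + suc e)) p     ≡⟨ sumBelow-cong p (λ i _ → cong f (+-suc i e)) ⟩
    sumBelow (λ i → g (suc i)) p         ≡⟨ +-cancelˡ-≡ (g 0) _ _ rotate-once ⟩
    sumBelow g p                         ≡⟨ sumBelow-rotate per e ⟩
    sumBelow f p                         ∎
  where
    open ≡-Reasoning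
    g = λ i → f (i + e)
    rotate-once : g 0 + sumBelow (λ i → g (suc i)) p ≡ g 0 + sumBelow g p
    rotate-once = begin
      g 0 + sumBelow (λ i → g (suc i)) p ≡⟨ sumBelow-unshift g p ⟨
      sumBelow g p + g p                 ≡⟨ cong (sumBelow g p +_) (trans (cong f (+-comm p e)) (per e)) ⟩
      sumBelow g p + g 0                 ≡⟨ +-comm (sumBelow g p) (g 0) ⟩
      g 0 + sumBelow g p                 ∎

antiperiodic-sum : ∀ {f p} e → Periodic f p → (∀ i → f (i + e) + f i ≡ 1) → 2 * sumBelow f p ≡ p
antiperiodic-sum {f} {p} e per flip = begin
    2 * sumBelow f p                              ≡⟨ cong (sumBelow f p +_) (+-identityʳ (sumBelow f p)) ⟩
    sumBelow f p + sumBelow f p                   ≡⟨ cong (_+ sumBelow f p) (sumBelow-rotate per e) ⟨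
    sumBelow (λ i → f (i + e)) p + sumBelow f p   ≡⟨ sumBelow-+ (λ i → f (i + e)) f p ⟨
    sumBelow (λ i → f (i + e) + f i) p            ≡⟨ sumBelow-cong p (λ i _ → flip i) ⟩
    sumBelow (λ _ → 1) p                          ≡⟨ sumBelow-const 1 p ⟩
    p * 1                                         ≡⟨ *-identityʳ p ⟩
    p                                             ∎
  where open ≡-Reasoning

countDigit-snoc : ∀ s d p → countDigit s d (suc p) ≡ countDigit s d p + length (filter (λ n → s n ≟ d) [ p ])
countDigit-snoc s d p = begin
    length (filter P? (upTo (suc p)))
      ≡⟨ cong (λ l → length (filter P? l)) (applyUpTo-∷ʳ (λ n → n) p) ⟨
    length (filter P? (upTo p ++ [ p ]))            ≡⟨ cong length (filter-++ P? (upTo p) [ p ]) ⟩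
    length (filter P? (upTo p) ++ filter P? [ p ])  ≡⟨ length-++ (filter P? (upTo p)) ⟩
    countDigit s d p + length (filter P? [ p ])     ∎
  where
    open ≡-Reasoning
    P? = λ n → s n ≟ d

countDigit-accept : ∀ s d p → s p ≡ d → countDigit s d (suc p) ≡ suc (countDigit s d p)
countDigit-accept s d p sp≡d = begin
    countDigit s d (suc p)                      ≡⟨ countDigit-snoc s d p ⟩
    countDigit s d p + length (filter P? [ p ]) ≡⟨ cong (λ l → countDigit s d p + length l) (filter-accept P? sp≡d) ⟩
    countDigit s d p + 1                        ≡⟨ +-comm (countDigit s d p) 1 ⟩
    suc (countDigit s d p)                      ∎
  where
    open ≡-Reasoning
    P? = λ n → s n ≟ d

countDigit-reject : ∀ s d p → s p ≢ d → countDigit s d (suc p) ≡ countDigit s d p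
countDigit-reject s d p sp≢d = begin
    countDigit s d (suc p)                      ≡⟨ countDigit-snoc s d p ⟩
    countDigit s d p + length (filter P? [ p ]) ≡⟨ cong (λ l → countDigit s d p + length l) (filter-reject P? sp≢d) ⟩
    countDigit s d p + 0                        ≡⟨ +-identityʳ (countDigit s d p) ⟩
    countDigit s d p                            ∎
  where
    open ≡-Reasoning
    P? = λ n → s n ≟ d

module _ (s : ℕ → ℕ) (s≤1 : ∀ n → s n ≤ 1) where

  countDigit-1≡sumBelow : ∀ p → countDigit s 1 p ≡ sumBelow s p
  countDigit-1≡sumBelow zero = refl
  countDigit-1≡sumBelow (suc p) with n≤1⇒n≡0∨n≡1 (s≤1 p)
  ... | inj₁ sp≡0 = begin
      countDigit s 1 (suc p) ≡⟨ countDigit-reject s 1 p (subst (_≢ 1) (sym sp≡0) 0≢1+n) ⟩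
      countDigit s 1 p       ≡⟨ countDigit-1≡sumBelow p ⟩
      sumBelow s p           ≡⟨ +-identityʳ (sumBelow s p) ⟨
      sumBelow s p + 0       ≡⟨ cong (sumBelow s p +_) sp≡0 ⟨
      sumBelow s (suc p)     ∎
    where open ≡-Reasoning
  ... | inj₂ sp≡1 = begin
      countDigit s 1 (suc p)   ≡⟨ countDigit-accept s 1 p sp≡1 ⟩
      suc (countDigit s 1 p)   ≡⟨ cong suc (countDigit-1≡sumBelow p) ⟩
      suc (sumBelow s p)       ≡⟨ +-comm 1 (sumBelow s p) ⟩
      sumBelow s p + 1         ≡⟨ cong (sumBelow s p +_) sp≡1 ⟨
      sumBelow s (suc p)       ∎
    where open ≡-Reasoning

  countDigit-0+countDigit-1 : ∀ p → countDigit s 0 p + countDigit s 1 p ≡ p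
  countDigit-0+countDigit-1 zero = refl
  countDigit-0+countDigit-1 (suc p) with n≤1⇒n≡0∨n≡1 (s≤1 p)
  ... | inj₁ sp≡0 = trans
      (cong₂ _+_ (countDigit-accept s 0 p sp≡0) (countDigit-reject s 1 p (subst (_≢ 1) (sym sp≡0) 0≢1+n)))
      (cong suc (countDigit-0+countDigit-1 p))
  ... | inj₂ sp≡1 = trans
      (cong₂ _+_ (countDigit-reject s 0 p (subst (_≢ 0) (sym sp≡1) 1+n≢0)) (countDigit-accept s 1 p sp≡1))
      (trans (+-suc _ _) (cong suc (countDigit-0+countDigit-1 p)))

  countDigit-halves : ∀ p → 2 * sumBelow s p ≡ p → 2 * countDigit s 0 p ≡ p × 2 * countDigit s 1 p ≡ p
  countDigit-halves p 2Σ≡p = trans (cong (2 *_) count₀≡count₁) 2count₁≡p , 2count₁≡p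
    where
      2count₁≡p : 2 * countDigit s 1 p ≡ p
      2count₁≡p = trans (cong (2 *_) (countDigit-1≡sumBelow p)) 2Σ≡p
      count₀≡count₁ : countDigit s 0 p ≡ countDigit s 1 p
      count₀≡count₁ = +-cancelʳ-≡ (countDigit s 1 p) _ _
        (trans (countDigit-0+countDigit-1 p) (trans (sym 2count₁≡p) (cong (countDigit s 1 p +_) (+-identityʳ _))))

x+x≢1 : ∀ x → x + x ≢ 1
x+x≢1 (suc x) eq = 0≢1+n (trans (sym (suc-injective eq)) (+-suc x x))

module _ {s : ℕ → ℕ} where

  periodic-* : ∀ {p} → Periodic s p → ∀ c → Periodic s (c * p)
  periodic-* per zero n = cong s (+-identityʳ n)
  periodic-* {p} per (suc c) n = begin
      s (n + (p + c * p)) ≡⟨ cong s (+-assoc n p (c * p)) ⟨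
      s (n + p + c * p)   ≡⟨ periodic-* per c (n + p) ⟩
      s (n + p)           ≡⟨ per n ⟩
      s n                 ∎
    where open ≡-Reasoning

  periodic-cancelʳ : ∀ {p q} → Periodic s p → Periodic s (q + p) → Periodic s q
  periodic-cancelʳ {p} {q} per-p per-q+p n = begin
      s (n + q)       ≡⟨ per-p (n + q) ⟨
      s (n + q + p)   ≡⟨ cong s (+-assoc n q p) ⟩
      s (n + (q + p)) ≡⟨ per-q+p n ⟩
      s n             ∎
    where open ≡-Reasoning

  periodic-gcd : ∀ {p q} → Periodic s p → Periodic s q → Periodic s (gcd p q)
  periodic-gcd {p} {q} per-p per-q with Bézout.identity (gcd-GCD p q)
  ... | Bézout.+- x y eq = periodic-cancelʳ (periodic-* per-q y) (subst (Periodic s) (sym eq) (periodic-* per-p x))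
  ... | Bézout.-+ x y eq = periodic-cancelʳ (periodic-* per-p x) (subst (Periodic s) (sym eq) (periodic-* per-q y))

  periodic-∣ : ∀ {d p} → Periodic s d → d ∣ p → Periodic s p
  periodic-∣ per (divides c refl) = periodic-* per c

odd⇒coprime-2 : ∀ {c} → ¬ 2 ∣ c → Coprime c 2
odd⇒coprime-2 2∤c (i∣c , i∣2) with prime⇒irreducible prime[2] i∣2
... | inj₁ i≡1 = i≡1
... | inj₂ refl = ⊥-elim (2∤c i∣c)

odd-∣-2^*⇒∣ : ∀ {c} → ¬ 2 ∣ c → ∀ j {n} → c ∣ 2 ^ j * n → c ∣ n
odd-∣-2^*⇒∣ {c} 2∤c zero {n} c∣ = subst (c ∣_) (*-identityˡ n) c∣
odd-∣-2^*⇒∣ {c} 2∤c (suc j) {n} c∣ =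
  odd-∣-2^*⇒∣ 2∤c j (coprime-divisor (odd⇒coprime-2 2∤c) (subst (c ∣_) (*-assoc 2 (2 ^ j) n) c∣))

prime[3] : Prime 3
prime[3] = toWitness {a? = prime? 3} _

-- The cofactor of a proper divisor is either even or an odd divisor of 3 other than 1.
∣3*2^suc⇒∣ : ∀ j {d} → d ∣ 3 * 2 ^ suc j → d < 3 * 2 ^ suc j → d ∣ 3 * 2 ^ j ⊎ d ∣ 2 ^ suc j
∣3*2^suc⇒∣ j {d} (divides c N≡c*d) d<N with 2 ∣? c
... | yes (divides c′ refl) = inj₁ (divides c′ (*-cancelˡ-≡ _ _ 2 (begin
    2 * (3 * 2 ^ j)  ≡⟨ lemma₁ (2 ^ j) ⟩
    3 * 2 ^ suc j    ≡⟨ N≡c*d ⟩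
    c′ * 2 * d       ≡⟨ lemma₂ c′ d ⟩
    2 * (c′ * d)     ∎)))
  where
    open ≡-Reasoning
    lemma₁ : ∀ E → 2 * (3 * E) ≡ 3 * (2 * E)
    lemma₁ = solve-∀
    lemma₂ : ∀ c d → c * 2 * d ≡ 2 * (c * d)
    lemma₂ = solve-∀
... | no 2∤c with prime⇒irreducible prime[3] (odd-∣-2^*⇒∣ 2∤c (suc j) c∣2^suc*3)
  where
    c∣2^suc*3 : c ∣ 2 ^ suc j * 3
    c∣2^suc*3 = divides d (trans (*-comm (2 ^ suc j) 3) (trans N≡c*d (*-comm c d)))
...   | inj₁ refl = ⊥-elim (<-irrefl (sym (trans N≡c*d (+-identityʳ d))) d<N)
...   | inj₂ refl = inj₂ (divides 1 (trans (*-cancelˡ-≡ _ _ 3 N≡c*d) (sym (*-identityˡ d))))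

module _ (m : ℕ) where
  private
    k = 5 + m

  Φ-periodic : Periodic (Φ k) (3 * 2 ^ k)
  Φ-periodic n with shiftLaw (3 + m)
  ... | a , c , law = digit-keep k D (trans (law n) (cong (fib n +_) (2^suc*x≡2^j*2x k D)))
    where D = (4 * c + 3) * fib n + 2 * (4 * a + 1) * fib (suc n)

  Φ-keep-at-0 : Φ k (3 * 2 ^ (4 + m)) ≡ Φ k 0
  Φ-keep-at-0 with shiftLaw (2 + m)
  ... | a , c , law = digit-keep k (4 * a + 1) (trans (law 0) (cong (2 ^ k *_) (lemma a c)))
    where
      lemma : ∀ a c → (4 * c + 3) * 0 + 2 * (4 * a + 1) * 1 ≡ 2 * (4 * a + 1)
      lemma = solve-∀

  Φ-flip-odd : ∀ n → Odd (fib n) → Φ k (n + 3 * 2 ^ (4 + m)) + Φ k n ≡ 1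
  Φ-flip-odd n (v , Fn≡) with shiftLaw (2 + m)
  ... | a , c , law = digit-flip k w (begin
      fib (n + 3 * 2 ^ (4 + m))
        ≡⟨ law n ⟩
      fib n + 2 ^ k * ((4 * c + 3) * fib n + 2 * (4 * a + 1) * fib (suc n))
        ≡⟨ cong (λ F → fib n + 2 ^ k * ((4 * c + 3) * F + 2 * (4 * a + 1) * fib (suc n))) Fn≡ ⟩
      fib n + 2 ^ k * ((4 * c + 3) * (2 * v + 1) + 2 * (4 * a + 1) * fib (suc n))
        ≡⟨ cong (λ D → fib n + 2 ^ k * D) (lemma a c v (fib (suc n))) ⟩
      fib n + 2 ^ k * (2 * w + 1) ∎)
    where
      open ≡-Reasoning
      w = 4 * c * v + 2 * c + 3 * v + 1 + (4 * a + 1) * fib (suc n)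
      lemma : ∀ a c v y → (4 * c + 3) * (2 * v + 1) + 2 * (4 * a + 1) * y
                        ≡ 2 * (4 * c * v + 2 * c + 3 * v + 1 + (4 * a + 1) * y) + 1
      lemma = solve-∀

  Φ-flip-0mod8 : ∀ n p q → fib n ≡ 8 * p → fib (suc n) ≡ 4 * q + 1 →
                 Φ k (n + 3 * 2 ^ (3 + m)) + Φ k n ≡ 1
  Φ-flip-0mod8 n p q Fn≡ Fsn≡ with shiftLaw (1 + m)
  ... | a , c , law = digit-flip k w (begin
      fib (n + 3 * 2 ^ (3 + m))
        ≡⟨ law n ⟩
      fib n + 2 ^ (4 + m) * ((4 * c + 3) * fib n + 2 * (4 * a + 1) * fib (suc n))
        ≡⟨ cong₂ (λ F F′ → fib n + 2 ^ (4 + m) * ((4 * c + 3) * F + 2 * (4 * a + 1) * F′)) Fn≡ Fsn≡ ⟩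
      fib n + 2 ^ (4 + m) * ((4 * c + 3) * (8 * p) + 2 * (4 * a + 1) * (4 * q + 1))
        ≡⟨ cong (λ D → fib n + 2 ^ (4 + m) * D) (lemma a c p q) ⟩
      fib n + 2 ^ (4 + m) * (2 * (2 * w + 1))
        ≡⟨ cong (fib n +_) (2^suc*x≡2^j*2x (4 + m) (2 * w + 1)) ⟨
      fib n + 2 ^ k * (2 * w + 1) ∎)
    where
      open ≡-Reasoning
      w = 2 * (4 * c + 3) * p + 2 * (4 * a + 1) * q + 2 * a
      lemma : ∀ a c p q → (4 * c + 3) * (8 * p) + 2 * (4 * a + 1) * (4 * q + 1)
                        ≡ 2 * (2 * (2 * (4 * c + 3) * p + 2 * (4 * a + 1) * q + 2 * a) + 1)
      lemma = solve-∀

  Φ-flip-2mod8 : ∀ n r s → fib n ≡ 8 * r + 2 → fib (suc n) ≡ 4 * s + 3 →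
                 Φ k (n + 3 * 2 ^ (2 + m)) + Φ k n ≡ 1
  Φ-flip-2mod8 n r s Fn≡ Fsn≡ with shiftLaw m
  ... | a , c , law = digit-flip k w (begin
      fib (n + 3 * 2 ^ (2 + m))
        ≡⟨ law n ⟩
      fib n + 2 ^ (3 + m) * ((4 * c + 3) * fib n + 2 * (4 * a + 1) * fib (suc n))
        ≡⟨ cong₂ (λ F F′ → fib n + 2 ^ (3 + m) * ((4 * c + 3) * F + 2 * (4 * a + 1) * F′)) Fn≡ Fsn≡ ⟩
      fib n + 2 ^ (3 + m) * ((4 * c + 3) * (8 * r + 2) + 2 * (4 * a + 1) * (4 * s + 3))
        ≡⟨ cong (λ D → fib n + 2 ^ (3 + m) * D) (lemma a c r s) ⟩
      fib n + 2 ^ (3 + m) * (2 * (2 * (2 * w + 1)))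
        ≡⟨ cong (fib n +_) (2^suc*x≡2^j*2x (3 + m) (2 * (2 * w + 1))) ⟨
      fib n + 2 ^ (4 + m) * (2 * (2 * w + 1))
        ≡⟨ cong (fib n +_) (2^suc*x≡2^j*2x (4 + m) (2 * w + 1)) ⟨
      fib n + 2 ^ k * (2 * w + 1) ∎)
    where
      open ≡-Reasoning
      w = (4 * c + 3) * r + (4 * a + 1) * s + c + 3 * a + 1
      lemma : ∀ a c r s → (4 * c + 3) * (8 * r + 2) + 2 * (4 * a + 1) * (4 * s + 3)
                        ≡ 2 * (2 * (2 * ((4 * c + 3) * r + (4 * a + 1) * s + c + 3 * a + 1) + 1))
      lemma = solve-∀

  Φ-class-flip : ∀ r → r < 6 → ∃ λ j → ∀ v → Φ k (r + v * 6 + 3 * 2 ^ suc j) + Φ k (r + v * 6) ≡ 1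
  Φ-class-flip 0 _ = 2 + m , λ v → let (p , q , F≡ , F′≡) = fib-mod8 v in Φ-flip-0mod8 (v * 6) p q F≡ F′≡
  Φ-class-flip 1 _ = 3 + m , λ v → Φ-flip-odd (1 + v * 6) (fib-odd-1+6u v)
  Φ-class-flip 2 _ = 3 + m , λ v → Φ-flip-odd (2 + v * 6) (fib-odd-2+6u v)
  Φ-class-flip 3 _ = 1 + m , λ v → let (r , s , F≡ , F′≡) = fib-3+6u v in Φ-flip-2mod8 (3 + v * 6) r s F≡ F′≡
  Φ-class-flip 4 _ = 3 + m , λ v → Φ-flip-odd (4 + v * 6) (fib-odd-4+6u v)
  Φ-class-flip 5 _ = 3 + m , λ v → Φ-flip-odd (5 + v * 6) (fib-odd-5+6u v)
  Φ-class-flip (suc (suc (suc (suc (suc (suc _)))))) (s≤s (s≤s (s≤s (s≤s (s≤s (s≤s ()))))))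

  Φ-class-periodic : ∀ r → Periodic (λ v → Φ k (r + v * 6)) (2 ^ (4 + m))
  Φ-class-periodic r v = trans (cong (Φ k) (class-index r v (4 + m))) (Φ-periodic (r + v * 6))

  Φ-class-sum : ∀ r → r < 6 → 2 * sumBelow (λ v → Φ k (r + v * 6)) (2 ^ (4 + m)) ≡ 2 ^ (4 + m)
  Φ-class-sum r r<6 with Φ-class-flip r r<6
  ... | j , flip = antiperiodic-sum (2 ^ j) (Φ-class-periodic r)
                     (λ v → trans (cong (λ n → Φ k n + Φ k (r + v * 6)) (class-index r v j)) (flip v))

  Φ-sum : 2 * sumBelow (Φ k) (3 * 2 ^ k) ≡ 3 * 2 ^ k
  Φ-sum = begin
      2 * sumBelow (Φ k) (3 * 2 ^ k)        ≡⟨ cong (λ n → 2 * sumBelow (Φ k) n) (lemma (2 ^ (4 + m))) ⟩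
      2 * sumBelow (Φ k) (Q * 6)            ≡⟨ cong (2 *_) (sumBelow-residues (Φ k) 6 Q) ⟩
      2 * sumBelow class 6                  ≡⟨ *-distribˡ-sumBelow 2 class 6 ⟩
      sumBelow (λ r → 2 * class r) 6        ≡⟨ sumBelow-cong 6 Φ-class-sum ⟩
      sumBelow (λ _ → Q) 6                                      ≡⟨ sumBelow-const Q 6 ⟩
      6 * Q                                                     ≡⟨ *-comm 6 Q ⟩
      Q * 6                                                     ≡⟨ lemma Q ⟨
      3 * 2 ^ k                                                 ∎
    where
      open ≡-Reasoning
      Q = 2 ^ (4 + m)
      class = λ r → sumBelow (λ v → Φ k (r + v * 6)) Q
      lemma : ∀ Q → 3 * (2 * Q) ≡ Q * 6
      lemma = solve-∀

  Φ-not-periodic-half : ¬ Periodic (Φ k) (3 * 2 ^ (4 + m))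
  Φ-not-periodic-half per = x+x≢1 (Φ k 1) (trans (cong (_+ Φ k 1) (sym (per 1))) (Φ-flip-odd 1 (0 , refl)))

  -- With Q = 2^(k-1), period 2^k = 2Q sends both Q (via 3Q) and Q + 3Q back to the value at 0, where the
  -- half-period shift 3Q keeps the digit; but F Q is odd, so that shift flips the digit at Q.
  Φ-not-periodic-third : ¬ Periodic (Φ k) (2 ^ k)
  Φ-not-periodic-third per = x+x≢1 (Φ k 0) (begin
      Φ k 0 + Φ k 0                          ≡⟨ cong₂ _+_ Φ[Q+H]≡Φ[0] Φ[Q]≡Φ[0] ⟨
      Φ k (Q + 3 * 2 ^ (4 + m)) + Φ k Q      ≡⟨ Φ-flip-odd Q (fib-odd-2^suc (3 + m)) ⟩
      1                                      ∎)
    where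
      open ≡-Reasoning
      Q = 2 ^ (4 + m)
      Φ[Q+H]≡Φ[0] : Φ k (Q + 3 * 2 ^ (4 + m)) ≡ Φ k 0
      Φ[Q+H]≡Φ[0] = trans (cong (Φ k) (lemma₄ Q)) (periodic-* per 2 0)
        where
          lemma₄ : ∀ Q → Q + 3 * Q ≡ 0 + 2 * (2 * Q)
          lemma₄ = solve-∀
      Φ[Q]≡Φ[0] : Φ k Q ≡ Φ k 0
      Φ[Q]≡Φ[0] = trans (sym (per Q)) (trans (cong (Φ k) (lemma₃ Q)) Φ-keep-at-0)
        where
          lemma₃ : ∀ Q → Q + 2 * Q ≡ 3 * Q
          lemma₃ = solve-∀

  Φ-no-proper-period : ∀ {d} → Periodic (Φ k) d → d ∣ 3 * 2 ^ k → d < 3 * 2 ^ k → ⊥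
  Φ-no-proper-period per d∣P d<P with ∣3*2^suc⇒∣ (4 + m) d∣P d<P
  ... | inj₁ d∣half = Φ-not-periodic-half (periodic-∣ per d∣half)
  ... | inj₂ d∣third = Φ-not-periodic-third (periodic-∣ per d∣third)

  Φ-minimal : ∀ q → IsPeriod (Φ k) q → 3 * 2 ^ k ≤ q
  Φ-minimal q (0<q , per) with 3 * 2 ^ k ≤? q
  ... | yes P≤q = P≤q
  ... | no P≰q = ⊥-elim (Φ-no-proper-period per-g (gcd[m,n]∣n q (3 * 2 ^ k)) g<P)
    where
      instance
        q≢0 : NonZero q
        q≢0 = >-nonZero 0<q
      per-g : Periodic (Φ k) (gcd q (3 * 2 ^ k))
      per-g = periodic-gcd per Φ-periodic
      g<P : gcd q (3 * 2 ^ k) < 3 * 2 ^ k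
      g<P = ≤-<-trans (∣⇒≤ (gcd[m,n]∣m q (3 * 2 ^ k))) (≰⇒> P≰q)

  Φ-shortest-period : IsShortestPeriod (Φ k) (3 * 2 ^ k)
  Φ-shortest-period = (*-monoʳ-< 3 (m^n>0 2 k) , Φ-periodic) , Φ-minimal

mainTheorem10 : (k : ℕ) → 5 ≤ k →
    Σ ℕ (λ p → IsShortestPeriod (Φ k) p
                 × (2 * countDigit (Φ k) 0 p ≡ p)
                 × (2 * countDigit (Φ k) 1 p ≡ p))
mainTheorem10 .(5 + m) (s≤s (s≤s (s≤s (s≤s (s≤s {n = m} _))))) =
  3 * 2 ^ (5 + m) , Φ-shortest-period m ,
  countDigit-halves (Φ (5 + m)) (digit≤1 (5 + m) ∘ fib) (3 * 2 ^ (5 + m)) (Φ-sum m)
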